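{- Let $l\ge 1$ and $k\ge 1$ be integers, and let $\tau=11\cdots1$ be the generalized pattern consisting of $l$ consecutive (unhyphenated) copies of the letter $1$. For a word $\sigma=\sigma_1\cdots\sigma_n\in[k]^n$, let $\#\tau(\sigma)$ be the number of indices $i$ with $1\le i\le n-l+1$ and $\sigma_i=\sigma_{i+1}=\cdots=\sigma_{i+l-1}$. Let \[ F_\tau(x;k;q)=\sum_{n\ge 0}\sum_{\sigma\in[k]^n} q^{\#\tau(\sigma)}x^n . \] Then, as an identity of rational functions in $x$ and $q$, \[ F_{\tau}(x;k;q)=\frac{1+(1-q)x\sum_{j=0}^{l-2} (kx)^j -(1-q)(k-1)\sum_{d=2}^{l-1}x^d\sum_{j=0}^{l-1-d} (kx)^j}{1-(k-1+q)x-(k-1)(1-q)(1-x^{l-2})\frac{x^2}{1-x}}. \]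
   Context: $[k]^n$ denotes the set of words of length $n$ over the alphabet $\{1,\dots,k\}$; $[k]^0$ consists of the empty word. Empty sums are $0$. -}

module Defs where

open import Data.Nat as ℕ using (ℕ; zero; suc; _∸_; _≤ᵇ_; _≡ᵇ_)
open import Data.Integer as ℤ using (ℤ; +_; _+_; _*_; _-_; -_)
open import Data.Fin using (Fin; toℕ)
open import Data.List using (List; []; _∷_; length; take; map; concatMap; allFin; [_])
open import Data.Vec using (Vec; toList)
open import Data.Bool using (Bool; true; false; _∧_; if_then_else_)

allEq : ∀ {k} → Fin k → List (Fin k) → Bool
allEq a []       = true
allEq a (b ∷ bs) = (toℕ a ≡ᵇ toℕ b) ∧ allEq a bs

startsRun : ∀ {k} → ℕ → List (Fin k) → Bool
startsRun l []      = false
startsRun l (a ∷ w) = ((l ∸ 1) ≤ᵇ length w) ∧ allEq a (take (l ∸ 1) w)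

occ : ∀ {k} → ℕ → List (Fin k) → ℕ
occ l []      = 0
occ l (a ∷ w) = (if startsRun l (a ∷ w) then 1 else 0) ℕ.+ occ l w

#τ : ∀ {k n} → ℕ → Vec (Fin k) n → ℕ
#τ l σ = occ l (toList σ)

words : (k n : ℕ) → List (Vec (Fin k) n)
words k zero    = [ Data.Vec.[] ]
words k (suc n) = concatMap (λ a → map (a Data.Vec.∷_) (words k n)) (allFin k)

sumL : List ℤ → ℤ
sumL []       = + 0
sumL (x ∷ xs) = x + sumL xs

-- Formal power series in x with integer coefficients (q is a fixed integer)

Series : Set
Series = ℕ → ℤ

sumTo : ℕ → (ℕ → ℤ) → ℤ
sumTo zero    f = + 0
sumTo (suc m) f = sumTo m f + f m

const : ℤ → Series
const c zero    = c
const c (suc _) = + 0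

X : Series
X 1 = + 1
X _ = + 0

_⊕_ : Series → Series → Series
(f ⊕ g) n = f n + g n

_⊝_ : Series → Series → Series
(f ⊝ g) n = f n - g n

_⊗_ : Series → Series → Series
(f ⊗ g) n = sumTo (suc n) (λ i → f i * g (n ∸ i))

infixl 6 _⊕_ _⊝_
infixl 7 _⊗_

_^ˢ_ : Series → ℕ → Series
s ^ˢ zero  = const (+ 1)
s ^ˢ suc m = s ⊗ (s ^ˢ m)

Σfrom_count_ : ℕ → ℕ → (ℕ → Series) → Series
(Σfrom a count zero) s n    = + 0
(Σfrom a count suc c) s n   = (Σfrom a count c) s n + s (a ℕ.+ c) n

Fτ : (l k : ℕ) → ℤ → Series
Fτ l k q n = sumL (map (λ σ → q ℤ.^ #τ l σ) (words k n))

Num : (l k : ℕ) → ℤ → Series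
Num l k q =
  const (+ 1)
  ⊕ const (+ 1 - q) ⊗ X ⊗ (Σfrom 0 count (l ∸ 1)) (λ j → (const (+ k) ⊗ X) ^ˢ j)
  ⊝ const ((+ 1 - q) * (+ k - + 1))
      ⊗ (Σfrom 2 count (l ∸ 2))
          (λ d → (X ^ˢ d) ⊗ (Σfrom 0 count (l ∸ d)) (λ j → (const (+ k) ⊗ X) ^ˢ j))

-- (1 - x) times the denominator
-- 1 - (k-1+q) x - (k-1)(1-q)(1 - x^{l-2}) x^2/(1-x),
-- i.e. (1-x)(1-(k-1+q)x) - (k-1)(1-q)(x^2 - x^l)
DenTimes1-x : (l k : ℕ) → ℤ → Series
DenTimes1-x l k q =
  (const (+ 1) ⊝ X) ⊗ (const (+ 1) ⊝ const (+ k - + 1 + q) ⊗ X)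
  ⊝ const ((+ k - + 1) * (+ 1 - q)) ⊗ ((X ^ˢ 2) ⊝ (X ^ˢ l))

module Submission where

open import Defs
open import Algebra.Bundles using (CommutativeMonoid; CommutativeRing)
open import Algebra.Structures using (IsCommutativeRing)
import Algebra.Construct.Pointwise as Pointwise
open import Algebra.Solver.Ring.AlmostCommutativeRing
  using (AlmostCommutativeRing; fromCommutativeRing; _-Raw-AlmostCommutative⟶_)
import Algebra.Solver.Ring as RingSolver
open import Data.Bool using (Bool; true; false; _∧_; if_then_else_)
import Data.Bool.Properties as Boolₚ
open import Data.Fin using (Fin; toℕ) renaming (zero to fzero; suc to fsuc)
open import Data.Integer as ℤ using (ℤ; +_; _+_; _*_; _-_; -_)
import Data.Integer.Properties as ℤₚ
open import Data.Integer.Tactic.RingSolver using (solve-∀)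
open import Data.List using (List; []; _∷_; _++_; length; take; map; concatMap; allFin; tabulate)
import Data.List.Properties as List
open import Data.Maybe using (Maybe; just; nothing)
open import Data.Nat as ℕ using (ℕ; zero; suc; _∸_; _≤_; _<_; z≤n; s≤s; _≤ᵇ_; _≡ᵇ_)
import Data.Nat.Properties as ℕₚ
open import Data.Product using (_,_)
open import Data.Vec using (Vec; toList) renaming (_∷_ to _∷ᵛ_)
open import Function using (_∘_)
open import Relation.Binary.PropositionalEquality
open import Relation.Nullary using (yes; no)
open import Algebra.Properties.CommutativeSemigroup ℤₚ.+-commutativeSemigroup
  using (interchange)
open import Algebra.Properties.CommutativeSemigroup
  (CommutativeMonoid.commutativeSemigroup Boolₚ.∧-commutativeMonoid)
  using () renaming (x∙yz≈y∙xz to ∧-exchange)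

-- Let E_m be the series counting, with weight q^#τ, the pairs (a, σ) of a letter a
-- and a word σ that begins with m copies of a.  Prepending a to σ creates a new
-- occurrence of τ exactly when σ begins with l - 1 copies of a; with L = l - 1 this gives
--   F = 1 + x (k F + (q - 1) E_L),   E_0 = k F,   E_{m+1} = x (E_m + (q - 1) E_L)  (m < L).
-- Unfolding the second recurrence, E_L (1 - (q - 1) S) = k x^L F with S = x + ⋯ + x^L,
-- and eliminating E_L from the first equation gives F D = 1 - (q - 1) S, where
-- (1 - x) D is the series DenTimes1-x.  The stated numerator also collapses to 1 - (q - 1) S.

infix 4 _≈_
_≈_ : Series → Series → Set
f ≈ g = ∀ n → f n ≡ g n

0ˢ 1ˢ : Series
0ˢ _ = + 0
1ˢ = const (+ 1)

-ˢ_ : Series → Series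
(-ˢ f) n = - f n

shift : Series → Series
shift f n = f (suc n)

scale : ℤ → Series → Series
scale c f n = c * f n

sumTo-cong : ∀ m {f g : ℕ → ℤ} → (∀ i → f i ≡ g i) → sumTo m f ≡ sumTo m g
sumTo-cong zero    f≡g = refl
sumTo-cong (suc m) f≡g = cong₂ _+_ (sumTo-cong m f≡g) (f≡g m)

sumTo-+ : ∀ m (f g : ℕ → ℤ) → sumTo m (λ i → f i + g i) ≡ sumTo m f + sumTo m g
sumTo-+ zero    f g = refl
sumTo-+ (suc m) f g = trans (cong (_+ (f m + g m)) (sumTo-+ m f g))
                            (interchange (sumTo m f) (sumTo m g) (f m) (g m))

sumTo-*ˡ : ∀ m c (f : ℕ → ℤ) → sumTo m (λ i → c * f i) ≡ c * sumTo m f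
sumTo-*ˡ zero    c f = sym (ℤₚ.*-zeroʳ c)
sumTo-*ˡ (suc m) c f = trans (cong (_+ c * f m) (sumTo-*ˡ m c f))
                             (sym (ℤₚ.*-distribˡ-+ c (sumTo m f) (f m)))

sumTo-suc : ∀ m (f : ℕ → ℤ) → sumTo (suc m) f ≡ f 0 + sumTo m (f ∘ suc)
sumTo-suc zero    f = trans (ℤₚ.+-identityˡ (f 0)) (sym (ℤₚ.+-identityʳ (f 0)))
sumTo-suc (suc m) f = trans (cong (_+ f (suc m)) (sumTo-suc m f))
                            (ℤₚ.+-assoc (f 0) _ _)

⊗-zero : ∀ f g → (f ⊗ g) 0 ≡ f 0 * g 0
⊗-zero f g = ℤₚ.+-identityˡ _

⊗-suc : ∀ f g n → (f ⊗ g) (suc n) ≡ f 0 * g (suc n) + (shift f ⊗ g) n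
⊗-suc f g n = sumTo-suc (suc n) _

⊗-cong : ∀ {f f′ g g′} → f ≈ f′ → g ≈ g′ → f ⊗ g ≈ f′ ⊗ g′
⊗-cong f≈f′ g≈g′ n = sumTo-cong (suc n) (λ i → cong₂ _*_ (f≈f′ i) (g≈g′ (n ∸ i)))

⊗-distribʳ-⊕ : ∀ h f g → (f ⊕ g) ⊗ h ≈ f ⊗ h ⊕ g ⊗ h
⊗-distribʳ-⊕ h f g n =
  trans (sumTo-cong (suc n) (λ i → ℤₚ.*-distribʳ-+ (h (n ∸ i)) (f i) (g i)))
        (sumTo-+ (suc n) _ _)

scale-⊗ : ∀ c f g → scale c f ⊗ g ≈ scale c (f ⊗ g)
scale-⊗ c f g n =
  trans (sumTo-cong (suc n) (λ i → ℤₚ.*-assoc c (f i) (g (n ∸ i))))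
        (sumTo-*ˡ (suc n) c _)

const-⊗ : ∀ c g → const c ⊗ g ≈ scale c g
const-⊗ c g zero    = ⊗-zero (const c) g
const-⊗ c g (suc n) =
  trans (⊗-suc (const c) g n)
        (trans (cong (_+_ (c * g (suc n))) (sumTo-*ˡ (suc n) (+ 0) (λ i → g (n ∸ i))))
               (ℤₚ.+-identityʳ _))

⊗-identityˡ : ∀ g → 1ˢ ⊗ g ≈ g
⊗-identityˡ g n = trans (const-⊗ (+ 1) g n) (ℤₚ.*-identityˡ (g n))

⊗-comm : ∀ f g → f ⊗ g ≈ g ⊗ f
⊗-comm f g zero = trans (⊗-zero f g) (trans (ℤₚ.*-comm (f 0) (g 0)) (sym (⊗-zero g f)))
⊗-comm f g (suc zero) =
  begin
    (f ⊗ g) 1                 ≡⟨ ⊗-suc f g 0 ⟩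
    f 0 * g 1 + (shift f ⊗ g) 0 ≡⟨ cong (_+_ (f 0 * g 1)) (⊗-zero (shift f) g) ⟩
    f 0 * g 1 + f 1 * g 0     ≡⟨ swap (f 0) (g 1) (f 1) (g 0) ⟩
    g 0 * f 1 + g 1 * f 0     ≡⟨ cong (_+_ (g 0 * f 1)) (⊗-zero (shift g) f) ⟨
    g 0 * f 1 + (shift g ⊗ f) 0 ≡⟨ ⊗-suc g f 0 ⟨
    (g ⊗ f) 1                 ∎
  where
  open ≡-Reasoning
  swap : ∀ a b c d → a * b + c * d ≡ d * c + b * a
  swap = solve-∀
⊗-comm f g (suc (suc n)) =
  begin
    (f ⊗ g) (2 ℕ.+ n)
      ≡⟨ ⊗-suc f g (suc n) ⟩
    f 0 * g (2 ℕ.+ n) + (shift f ⊗ g) (suc n)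
      ≡⟨ cong (_+_ (f 0 * g (2 ℕ.+ n))) (trans (⊗-comm (shift f) g (suc n)) (⊗-suc g (shift f) n)) ⟩
    f 0 * g (2 ℕ.+ n) + (g 0 * f (2 ℕ.+ n) + (shift g ⊗ shift f) n)
      ≡⟨ cong (λ z → f 0 * g (2 ℕ.+ n) + (g 0 * f (2 ℕ.+ n) + z)) (⊗-comm (shift g) (shift f) n) ⟩
    f 0 * g (2 ℕ.+ n) + (g 0 * f (2 ℕ.+ n) + (shift f ⊗ shift g) n)
      ≡⟨ swap (f 0 * g (2 ℕ.+ n)) (g 0 * f (2 ℕ.+ n)) _ ⟩
    g 0 * f (2 ℕ.+ n) + (f 0 * g (2 ℕ.+ n) + (shift f ⊗ shift g) n)
      ≡⟨ cong (_+_ (g 0 * f (2 ℕ.+ n))) (trans (⊗-comm (shift g) f (suc n)) (⊗-suc f (shift g) n)) ⟨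
    g 0 * f (2 ℕ.+ n) + (shift g ⊗ f) (suc n)
      ≡⟨ ⊗-suc g f (suc n) ⟨
    (g ⊗ f) (2 ℕ.+ n)
      ∎
  where
  open ≡-Reasoning
  swap : ∀ a b c → a + (b + c) ≡ b + (a + c)
  swap = solve-∀

⊗-assoc : ∀ f g h → (f ⊗ g) ⊗ h ≈ f ⊗ (g ⊗ h)
⊗-assoc f g h zero =
  begin
    ((f ⊗ g) ⊗ h) 0   ≡⟨ trans (⊗-zero (f ⊗ g) h) (cong (_* h 0) (⊗-zero f g)) ⟩
    f 0 * g 0 * h 0   ≡⟨ ℤₚ.*-assoc (f 0) (g 0) (h 0) ⟩
    f 0 * (g 0 * h 0) ≡⟨ trans (⊗-zero f (g ⊗ h)) (cong (f 0 *_) (⊗-zero g h)) ⟨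
    (f ⊗ (g ⊗ h)) 0   ∎
  where open ≡-Reasoning
⊗-assoc f g h (suc n) =
  begin
    ((f ⊗ g) ⊗ h) (suc n)
      ≡⟨ ⊗-suc (f ⊗ g) h n ⟩
    (f ⊗ g) 0 * h (suc n) + (shift (f ⊗ g) ⊗ h) n
      ≡⟨ cong₂ _+_ (cong (_* h (suc n)) (⊗-zero f g)) (⊗-cong {g = h} (⊗-suc f g) (λ _ → refl) n) ⟩
    f 0 * g 0 * h (suc n) + ((scale (f 0) (shift g) ⊕ shift f ⊗ g) ⊗ h) n
      ≡⟨ cong (_+_ (f 0 * g 0 * h (suc n))) (⊗-distribʳ-⊕ h (scale (f 0) (shift g)) (shift f ⊗ g) n) ⟩
    f 0 * g 0 * h (suc n) + ((scale (f 0) (shift g) ⊗ h) n + ((shift f ⊗ g) ⊗ h) n)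
      ≡⟨ cong (_+_ (f 0 * g 0 * h (suc n))) (cong₂ _+_ (scale-⊗ (f 0) (shift g) h n) (⊗-assoc (shift f) g h n)) ⟩
    f 0 * g 0 * h (suc n) + (f 0 * (shift g ⊗ h) n + (shift f ⊗ (g ⊗ h)) n)
      ≡⟨ factor (f 0) (g 0) (h (suc n)) _ _ ⟩
    f 0 * (g 0 * h (suc n) + (shift g ⊗ h) n) + (shift f ⊗ (g ⊗ h)) n
      ≡⟨ cong (λ z → f 0 * z + (shift f ⊗ (g ⊗ h)) n) (⊗-suc g h n) ⟨
    f 0 * (g ⊗ h) (suc n) + (shift f ⊗ (g ⊗ h)) n
      ≡⟨ ⊗-suc f (g ⊗ h) n ⟨
    (f ⊗ (g ⊗ h)) (suc n)
      ∎
  where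
  open ≡-Reasoning
  factor : ∀ a b c d e → a * b * c + (a * d + e) ≡ a * (b * c + d) + e
  factor = solve-∀

⊗-isCommutativeRing : IsCommutativeRing _≈_ _⊕_ _⊗_ -ˢ_ 0ˢ 1ˢ
⊗-isCommutativeRing = record
  { isRing = record
    { +-isAbelianGroup = Pointwise.isAbelianGroup ℕ ℤₚ.+-0-isAbelianGroup
    ; *-cong           = ⊗-cong
    ; *-assoc          = ⊗-assoc
    ; *-identity       = ⊗-identityˡ , λ g n → trans (⊗-comm g 1ˢ n) (⊗-identityˡ g n)
    ; distrib          = (λ f g h n → trans (⊗-comm f (g ⊕ h) n)
                                       (trans (⊗-distribʳ-⊕ f g h n)
                                              (cong₂ _+_ (⊗-comm g f n) (⊗-comm h f n))))
                       , ⊗-distribʳ-⊕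
    }
  ; *-comm = ⊗-comm
  }

seriesRing : CommutativeRing _ _
seriesRing = record { isCommutativeRing = ⊗-isCommutativeRing }

const-+ : ∀ a b → const (a + b) ≈ const a ⊕ const b
const-+ a b zero    = refl
const-+ a b (suc n) = refl

const-- : ∀ a b → const (a - b) ≈ const a ⊝ const b
const-- a b zero    = refl
const-- a b (suc n) = refl

const-neg : ∀ a → const (- a) ≈ -ˢ const a
const-neg a zero    = refl
const-neg a (suc n) = refl

const-* : ∀ a b → const (a * b) ≈ const a ⊗ const b
const-* a b n = sym (trans (const-⊗ a (const b) n) (scale-const n))
  where
  scale-const : ∀ n → a * const b n ≡ const (a * b) n
  scale-const zero    = refl
  scale-const (suc n) = ℤₚ.*-zeroʳ a

seriesACR : AlmostCommutativeRing _ _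
seriesACR = fromCommutativeRing seriesRing

const-homomorphism : ℤ.+-*-rawRing -Raw-AlmostCommutative⟶ seriesACR
const-homomorphism = record
  { ⟦_⟧    = const
  ; +-homo = const-+
  ; *-homo = const-*
  ; -‿homo = const-neg
  ; 0-homo = λ { zero → refl ; (suc n) → refl }
  ; 1-homo = λ n → refl
  }

const-≟ : ∀ a b → Maybe (const a ≈ const b)
const-≟ a b with a ℤₚ.≟ b
... | yes refl = just (λ n → refl)
... | no _     = nothing

open RingSolver ℤ.+-*-rawRing seriesACR const-homomorphism const-≟
  using (solve; _:+_; _:-_; _:*_; con; _:=_)

module R = CommutativeRing seriesRing

X-⊗-suc : ∀ g n → (X ⊗ g) (suc n) ≡ g n
X-⊗-suc g n =
  trans (⊗-suc X g n)
        (trans (ℤₚ.+-identityˡ _) (trans (⊗-cong {g = g} shiftX≈1 (λ _ → refl) n) (⊗-identityˡ g n)))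
  where
  shiftX≈1 : shift X ≈ 1ˢ
  shiftX≈1 zero    = refl
  shiftX≈1 (suc n) = refl

Σfrom-cong : ∀ a c {s t : ℕ → Series} → (∀ d → s d ≈ t d) → (Σfrom a count c) s ≈ (Σfrom a count c) t
Σfrom-cong a zero    s≈t n = refl
Σfrom-cong a (suc c) s≈t n = cong₂ _+_ (Σfrom-cong a c s≈t n) (s≈t (a ℕ.+ c) n)

Σfrom-peel : ∀ a c s → (Σfrom a count (suc c)) s ≈ s a ⊕ (Σfrom (suc a) count c) s
Σfrom-peel a zero    s n = trans (ℤₚ.+-identityˡ _)
                                 (trans (cong (λ i → s i n) (ℕₚ.+-identityʳ a)) (sym (ℤₚ.+-identityʳ _)))
Σfrom-peel a (suc c) s n = trans (cong₂ _+_ (Σfrom-peel a c s n) (cong (λ i → s i n) (ℕₚ.+-suc a c)))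
                                 (ℤₚ.+-assoc (s a n) _ _)

Σfrom-shift : ∀ a c s → (Σfrom (suc a) count c) s ≈ (Σfrom a count c) (s ∘ suc)
Σfrom-shift a zero    s n = refl
Σfrom-shift a (suc c) s n = cong (_+ s (suc (a ℕ.+ c)) n) (Σfrom-shift a c s n)

Σfrom-⊗ˡ : ∀ a c y s → (Σfrom a count c) (λ d → y ⊗ s d) ≈ y ⊗ (Σfrom a count c) s
Σfrom-⊗ˡ a zero    y s = R.sym (R.zeroʳ y)
Σfrom-⊗ˡ a (suc c) y s n =
  trans (cong (_+ (y ⊗ s (a ℕ.+ c)) n) (Σfrom-⊗ˡ a c y s n))
        (sym (R.distribˡ y ((Σfrom a count c) s) (s (a ℕ.+ c)) n))

module _ where
  open import Relation.Binary.Reasoning.Setoid R.setoid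

  geometricSum : Series → ℕ → Series
  geometricSum y m = (Σfrom 0 count m) (y ^ˢ_)

  geometricSum-suc : ∀ y m → geometricSum y (suc m) ≈ 1ˢ ⊕ y ⊗ geometricSum y m
  geometricSum-suc y m =
    begin
      geometricSum y (suc m)                      ≈⟨ Σfrom-peel 0 m (y ^ˢ_) ⟩
      1ˢ ⊕ (Σfrom 1 count m) (y ^ˢ_)              ≈⟨ R.+-congˡ {1ˢ} (Σfrom-shift 0 m (y ^ˢ_)) ⟩
      1ˢ ⊕ (Σfrom 0 count m) (λ j → y ⊗ y ^ˢ j)   ≈⟨ R.+-congˡ {1ˢ} (Σfrom-⊗ˡ 0 m y (y ^ˢ_)) ⟩
      1ˢ ⊕ y ⊗ geometricSum y m                   ∎

  geometricSum-telescope : ∀ y m → (1ˢ ⊝ y) ⊗ geometricSum y m ≈ 1ˢ ⊝ y ^ˢ m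
  geometricSum-telescope y zero    = R.trans (R.zeroʳ (1ˢ ⊝ y)) (R.sym (R.-‿inverseʳ 1ˢ))
  geometricSum-telescope y (suc m) =
    begin
      (1ˢ ⊝ y) ⊗ geometricSum y (suc m)          ≈⟨ R.*-congˡ {1ˢ ⊝ y} (geometricSum-suc y m) ⟩
      (1ˢ ⊝ y) ⊗ (1ˢ ⊕ y ⊗ geometricSum y m)     ≈⟨ expand y (geometricSum y m) ⟩
      1ˢ ⊝ y ⊕ y ⊗ ((1ˢ ⊝ y) ⊗ geometricSum y m) ≈⟨ R.+-congˡ {1ˢ ⊝ y} (R.*-congˡ {y} (geometricSum-telescope y m)) ⟩
      1ˢ ⊝ y ⊕ y ⊗ (1ˢ ⊝ y ^ˢ m)                 ≈⟨ collapse y (y ^ˢ m) ⟩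
      1ˢ ⊝ y ^ˢ suc m                           ∎
    where
    expand : ∀ y g → (1ˢ ⊝ y) ⊗ (1ˢ ⊕ y ⊗ g) ≈ 1ˢ ⊝ y ⊕ y ⊗ ((1ˢ ⊝ y) ⊗ g)
    expand = solve 2 (λ y g → (con (+ 1) :- y) :* (con (+ 1) :+ y :* g)
                              := con (+ 1) :- y :+ y :* ((con (+ 1) :- y) :* g)) (λ _ → refl)
    collapse : ∀ y p → 1ˢ ⊝ y ⊕ y ⊗ (1ˢ ⊝ p) ≈ 1ˢ ⊝ y ⊗ p
    collapse = solve 2 (λ y p → con (+ 1) :- y :+ y :* (con (+ 1) :- p) := con (+ 1) :- y :* p) (λ _ → refl)

  -- For l = suc m this is, by computation, the double sum  Σ_{d=2}^{l-1} x^d Σ_{j=0}^{l-1-d} y^j  of Num.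
  doubleSum : Series → ℕ → Series
  doubleSum y m = (Σfrom 2 count (m ∸ 1)) (λ d → X ^ˢ d ⊗ geometricSum y (suc m ∸ d))

  doubleSum-suc : ∀ y m → doubleSum y (suc m) ≈ X ^ˢ 2 ⊗ geometricSum y m ⊕ X ⊗ doubleSum y m
  doubleSum-suc y zero    = R.sym (R.+-cong (R.zeroʳ (X ^ˢ 2)) (R.zeroʳ X))
  doubleSum-suc y (suc m) =
    begin
      doubleSum y (2 ℕ.+ m)
        ≈⟨ Σfrom-peel 2 m term ⟩
      term 2 ⊕ (Σfrom 3 count m) term
        ≈⟨ R.+-congˡ {term 2} (Σfrom-shift 2 m term) ⟩
      term 2 ⊕ (Σfrom 2 count m) (term ∘ suc)
        ≈⟨ R.+-congˡ {term 2} (Σfrom-cong 2 m (λ d → ⊗-assoc X (X ^ˢ d) (geometricSum y (2 ℕ.+ m ∸ d)))) ⟩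
      term 2 ⊕ (Σfrom 2 count m) (λ d → X ⊗ (X ^ˢ d ⊗ geometricSum y (2 ℕ.+ m ∸ d)))
        ≈⟨ R.+-congˡ {term 2} (Σfrom-⊗ˡ 2 m X _) ⟩
      X ^ˢ 2 ⊗ geometricSum y (suc m) ⊕ X ⊗ doubleSum y (suc m)
        ∎
    where
    term : ℕ → Series
    term d = X ^ˢ d ⊗ geometricSum y (3 ℕ.+ m ∸ d)

  doubleSum-collapse : ∀ K m →
    X ⊗ geometricSum (K ⊗ X) m ⊝ (K ⊝ 1ˢ) ⊗ doubleSum (K ⊗ X) m ≈ X ⊗ geometricSum X m
  doubleSum-collapse K zero    =
    R.trans (R.+-cong (R.zeroʳ X) (R.-‿cong (R.zeroʳ (K ⊝ 1ˢ)))) (R.sym (R.zeroʳ X))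
  doubleSum-collapse K (suc m) =
    begin
      X ⊗ geometricSum (K ⊗ X) (suc m) ⊝ (K ⊝ 1ˢ) ⊗ doubleSum (K ⊗ X) (suc m)
        ≈⟨ R.+-cong (R.*-congˡ {X} (geometricSum-suc (K ⊗ X) m))
                    (R.-‿cong (R.*-congˡ {K ⊝ 1ˢ} (doubleSum-suc (K ⊗ X) m))) ⟩
      X ⊗ (1ˢ ⊕ K ⊗ X ⊗ G) ⊝ (K ⊝ 1ˢ) ⊗ (X ^ˢ 2 ⊗ G ⊕ X ⊗ D)
        ≈⟨ regroup X K G D ⟩
      X ⊗ (1ˢ ⊕ (X ⊗ G ⊝ (K ⊝ 1ˢ) ⊗ D))
        ≈⟨ R.*-congˡ {X} (R.+-congˡ {1ˢ} (doubleSum-collapse K m)) ⟩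
      X ⊗ (1ˢ ⊕ X ⊗ geometricSum X m)
        ≈⟨ R.*-congˡ {X} (geometricSum-suc X m) ⟨
      X ⊗ geometricSum X (suc m)
        ∎
    where
    G D : Series
    G = geometricSum (K ⊗ X) m
    D = doubleSum (K ⊗ X) m
    regroup : ∀ x k g d → x ⊗ (1ˢ ⊕ k ⊗ x ⊗ g) ⊝ (k ⊝ 1ˢ) ⊗ (x ⊗ (x ⊗ 1ˢ) ⊗ g ⊕ x ⊗ d)
                        ≈ x ⊗ (1ˢ ⊕ (x ⊗ g ⊝ (k ⊝ 1ˢ) ⊗ d))
    regroup = solve 4 (λ x k g d →
      x :* (con (+ 1) :+ k :* x :* g) :- (k :- con (+ 1)) :* (x :* (x :* con (+ 1)) :* g :+ x :* d)
      := x :* (con (+ 1) :+ (x :* g :- (k :- con (+ 1)) :* d))) (λ _ → refl)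

sumMap : {A : Set} → (A → ℤ) → List A → ℤ
sumMap g xs = sumL (map g xs)

sumL-++ : ∀ xs ys → sumL (xs ++ ys) ≡ sumL xs + sumL ys
sumL-++ []       ys = sym (ℤₚ.+-identityˡ _)
sumL-++ (x ∷ xs) ys = trans (cong (_+_ x) (sumL-++ xs ys)) (sym (ℤₚ.+-assoc x _ _))

module _ {A : Set} where

  sumMap-cong : ∀ {g h : A → ℤ} xs → (∀ x → g x ≡ h x) → sumMap g xs ≡ sumMap h xs
  sumMap-cong []       g≡h = refl
  sumMap-cong (x ∷ xs) g≡h = cong₂ _+_ (g≡h x) (sumMap-cong xs g≡h)

  sumMap-linear : ∀ (g h : A → ℤ) c xs →
                  sumMap (λ x → g x + c * h x) xs ≡ sumMap g xs + c * sumMap h xs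
  sumMap-linear g h c []       = sym (trans (ℤₚ.+-identityˡ _) (ℤₚ.*-zeroʳ c))
  sumMap-linear g h c (x ∷ xs) =
    trans (cong (_+_ (g x + c * h x)) (sumMap-linear g h c xs)) (regroup (g x) (h x) _ _ c)
    where
    regroup : ∀ a b s t c → (a + c * b) + (s + c * t) ≡ (a + s) + c * (b + t)
    regroup = solve-∀

  sumMap-const : ∀ c (xs : List A) → sumMap (λ _ → c) xs ≡ + length xs * c
  sumMap-const c []       = refl
  sumMap-const c (x ∷ xs) =
    trans (cong (_+_ c) (sumMap-const c xs)) (sym (ℤₚ.suc-* (+ length xs) c))

sumMap-concatMap : ∀ {A B : Set} (g : B → ℤ) (h : A → List B) xs →
                   sumMap g (concatMap h xs) ≡ sumMap (sumMap g ∘ h) xs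
sumMap-concatMap g h []       = refl
sumMap-concatMap g h (x ∷ xs) =
  trans (cong sumL (List.map-++ g (h x) (concatMap h xs)))
        (trans (sumL-++ (map g (h x)) _) (cong (_+_ (sumMap g (h x))) (sumMap-concatMap g h xs)))

sumMap-map : ∀ {A B : Set} (g : B → ℤ) (f : A → B) xs → sumMap g (map f xs) ≡ sumMap (g ∘ f) xs
sumMap-map g f xs = cong sumL (sym (List.map-∘ xs))

sumMap-words-suc : ∀ k n (g : Vec (Fin k) (suc n) → ℤ) →
  sumMap g (words k (suc n)) ≡ sumMap (λ a → sumMap (g ∘ (a ∷ᵛ_)) (words k n)) (allFin k)
sumMap-words-suc k n g =
  trans (sumMap-concatMap g _ (allFin k))
        (sumMap-cong (allFin k) (λ a → sumMap-map g (a ∷ᵛ_) (words k n)))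

when : Bool → ℤ → ℤ
when b x = if b then x else + 0

when-∧ : ∀ b c x → when (b ∧ c) x ≡ when b (when c x)
when-∧ true  c x = refl
when-∧ false c x = refl

sumMap-when : ∀ {A : Set} b (g : A → ℤ) xs → sumMap (λ x → when b (g x)) xs ≡ when b (sumMap g xs)
sumMap-when true  g xs = refl
sumMap-when false g xs = trans (sumMap-const (+ 0) xs) (ℤₚ.*-zeroʳ (+ length xs))

sumL-tabulate-zero : ∀ k → sumL (tabulate {n = k} (λ _ → + 0)) ≡ + 0
sumL-tabulate-zero zero    = refl
sumL-tabulate-zero (suc k) = trans (ℤₚ.+-identityˡ _) (sumL-tabulate-zero k)

sumL-tabulate-δ : ∀ {k} (a : Fin k) (t : Fin k → ℤ) →
                  sumL (tabulate (λ b → when (toℕ a ≡ᵇ toℕ b) (t b))) ≡ t a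
sumL-tabulate-δ {suc k} fzero    t = trans (cong (_+_ (t fzero)) (sumL-tabulate-zero k))
                                           (ℤₚ.+-identityʳ (t fzero))
sumL-tabulate-δ {suc k} (fsuc a) t = trans (ℤₚ.+-identityˡ _) (sumL-tabulate-δ a (t ∘ fsuc))

sumMap-allFin-δ : ∀ {k} (a : Fin k) (t : Fin k → ℤ) →
                  sumMap (λ b → when (toℕ a ≡ᵇ toℕ b) (t b)) (allFin k) ≡ t a
sumMap-allFin-δ {k} a t =
  trans (cong sumL (List.map-tabulate {n = k} (λ b → b) (λ b → when (toℕ a ≡ᵇ toℕ b) (t b))))
        (sumL-tabulate-δ a t)

sumMap-allFin-const : ∀ k c → sumMap (λ (_ : Fin k) → c) (allFin k) ≡ + k * c
sumMap-allFin-const k c =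
  trans (sumMap-const c (allFin k)) (cong (λ m → + m * c) (List.length-tabulate {n = k} (λ b → b)))

-- startsRun (suc m) (a ∷ w) computes to beginsWith a m w: prepending a to σ adds one
-- occurrence of the pattern of length suc m exactly when beginsWith a m (toList σ).
beginsWith : ∀ {k} → Fin k → ℕ → List (Fin k) → Bool
beginsWith a m w = (m ≤ᵇ length w) ∧ allEq a (take m w)

beginsWith-suc : ∀ {k} (a b : Fin k) m w →
                 beginsWith a (suc m) (b ∷ w) ≡ (toℕ a ≡ᵇ toℕ b) ∧ beginsWith a m w
beginsWith-suc a b m w = trans (cong (_∧ allEq a (b ∷ take m w)) (suc≤ᵇsuc m (length w)))
                               (∧-exchange (m ≤ᵇ length w) (toℕ a ≡ᵇ toℕ b) _)
  where
  suc≤ᵇsuc : ∀ m n → (suc m ≤ᵇ suc n) ≡ (m ≤ᵇ n)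
  suc≤ᵇsuc zero    n = refl
  suc≤ᵇsuc (suc m) n = refl

beginsWith-mono : ∀ {k} (a : Fin k) {m M} w → m ≤ M → beginsWith a M w ≡ true → beginsWith a m w ≡ true
beginsWith-mono a w        z≤n       _ = refl
beginsWith-mono a []       (s≤s m≤M) ()
beginsWith-mono a {suc m} {suc M} (b ∷ w) (s≤s m≤M) begins
  rewrite beginsWith-suc a b M w | beginsWith-suc a b m w with toℕ a ≡ᵇ toℕ b
... | true  = beginsWith-mono a w m≤M begins
... | false = begins

when-pow-step : ∀ q b c o → (c ≡ true → b ≡ true) →
  when b (q ℤ.^ ((if c then 1 else 0) ℕ.+ o)) ≡ when b (q ℤ.^ o) + (q - + 1) * when c (q ℤ.^ o)
when-pow-step q true  true  o _ = peel q (q ℤ.^ o)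
  where
  peel : ∀ q r → q * r ≡ r + (q - + 1) * r
  peel = solve-∀
when-pow-step q true  false o _ =
  sym (trans (cong (_+_ (q ℤ.^ o)) (ℤₚ.*-zeroʳ (q - + 1))) (ℤₚ.+-identityʳ _))
when-pow-step q false true  o c⇒b with () ← c⇒b refl
when-pow-step q false false o _ = sym (trans (ℤₚ.+-identityˡ _) (ℤₚ.*-zeroʳ (q - + 1)))

module RunSums (k L : ℕ) (q : ℤ) where

  F : Series
  F = Fτ (suc L) k q

  runWeight : ∀ {n} → ℕ → Fin k → Vec (Fin k) n → ℤ
  runWeight m a σ = when (beginsWith a m (toList σ)) (q ℤ.^ #τ (suc L) σ)

  runSum : ℕ → Fin k → Series
  runSum m a n = sumMap (runWeight m a) (words k n)

  E : ℕ → Series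
  E m n = sumMap (λ a → runSum m a n) (allFin k)

  F-suc : ∀ n → F (suc n) ≡ + k * F n + (q - + 1) * E L n
  F-suc n =
    begin
      F (suc n)
    ≡⟨ sumMap-words-suc k n _ ⟩
      sumMap (λ a → sumMap (λ σ → q ℤ.^ #τ (suc L) (a ∷ᵛ σ)) (words k n)) (allFin k)
    ≡⟨ sumMap-cong (allFin k) (λ a →
         trans (sumMap-cong (words k n) (λ σ →
                  when-pow-step q true (beginsWith a L (toList σ)) (#τ (suc L) σ) (λ _ → refl)))
               (sumMap-linear _ (runWeight L a) (q - + 1) (words k n))) ⟩
      sumMap (λ a → F n + (q - + 1) * runSum L a n) (allFin k)
    ≡⟨ sumMap-linear (λ _ → F n) (λ a → runSum L a n) (q - + 1) (allFin k) ⟩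
      sumMap (λ _ → F n) (allFin k) + (q - + 1) * E L n
    ≡⟨ cong (_+ (q - + 1) * E L n) (sumMap-allFin-const k (F n)) ⟩
      + k * F n + (q - + 1) * E L n
    ∎
    where open ≡-Reasoning

  E-zero : ∀ n → E 0 n ≡ + k * F n
  E-zero n = sumMap-allFin-const k (F n)

  E-suc-zero : ∀ m → E (suc m) 0 ≡ + 0
  E-suc-zero m = trans (sumMap-allFin-const k (+ 0)) (ℤₚ.*-zeroʳ (+ k))

  runSum-suc : ∀ m a n → m < L → runSum (suc m) a (suc n) ≡ runSum m a n + (q - + 1) * runSum L a n
  runSum-suc m a n m<L =
    begin
      runSum (suc m) a (suc n)
    ≡⟨ sumMap-words-suc k n _ ⟩
      sumMap (λ b → sumMap (λ σ → runWeight (suc m) a (b ∷ᵛ σ)) (words k n)) (allFin k)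
    ≡⟨ sumMap-cong (allFin k) (λ b →
         trans (sumMap-cong (words k n) (λ σ →
                  trans (cong (λ β → when β (q ℤ.^ #τ (suc L) (b ∷ᵛ σ))) (beginsWith-suc a b m (toList σ)))
                        (when-∧ (toℕ a ≡ᵇ toℕ b) _ _)))
               (sumMap-when (toℕ a ≡ᵇ toℕ b) (weightAfter b) (words k n))) ⟩
      sumMap (λ b → when (toℕ a ≡ᵇ toℕ b) (sumMap (weightAfter b) (words k n))) (allFin k)
    ≡⟨ sumMap-allFin-δ a (λ b → sumMap (weightAfter b) (words k n)) ⟩
      sumMap (weightAfter a) (words k n)
    ≡⟨ sumMap-cong (words k n) (λ σ →
         when-pow-step q (beginsWith a m (toList σ)) (beginsWith a L (toList σ)) (#τ (suc L) σ)
                       (beginsWith-mono a (toList σ) (ℕₚ.<⇒≤ m<L))) ⟩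
      sumMap (λ σ → runWeight m a σ + (q - + 1) * runWeight L a σ) (words k n)
    ≡⟨ sumMap-linear (runWeight m a) (runWeight L a) (q - + 1) (words k n) ⟩
      runSum m a n + (q - + 1) * runSum L a n
    ∎
    where
    open ≡-Reasoning
    weightAfter : Fin k → Vec (Fin k) n → ℤ
    weightAfter b σ = when (beginsWith a m (toList σ)) (q ℤ.^ #τ (suc L) (b ∷ᵛ σ))

  E-suc : ∀ m n → m < L → E (suc m) (suc n) ≡ E m n + (q - + 1) * E L n
  E-suc m n m<L = trans (sumMap-cong (allFin k) (λ a → runSum-suc m a n m<L))
                        (sumMap-linear (λ a → runSum m a n) (λ a → runSum L a n) (q - + 1) (allFin k))

module Main (k L : ℕ) (q : ℤ) where
  open RunSums k L q
  open import Relation.Binary.Reasoning.Setoid R.setoid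

  K Q C G P : Series
  K = const (+ k)
  Q = const q
  C = Q ⊝ 1ˢ
  G = geometricSum X L
  P = X ^ˢ L

  C-⊗ : ∀ g n → (C ⊗ g) n ≡ (q - + 1) * g n
  C-⊗ g n = trans (⊗-cong {g = g} (R.sym (const-- q (+ 1))) (λ _ → refl) n) (const-⊗ (q - + 1) g n)

  F-series : F ≈ 1ˢ ⊕ X ⊗ (K ⊗ F ⊕ C ⊗ E L)
  F-series zero    = refl
  F-series (suc n) =
    trans (F-suc n)
          (sym (trans (ℤₚ.+-identityˡ _)
                      (trans (X-⊗-suc (K ⊗ F ⊕ C ⊗ E L) n)
                             (cong₂ _+_ (const-⊗ (+ k) F n) (C-⊗ (E L) n)))))

  E-suc-series : ∀ m → m < L → E (suc m) ≈ X ⊗ (E m ⊕ C ⊗ E L)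
  E-suc-series m m<L zero    = E-suc-zero m
  E-suc-series m m<L (suc n) =
    trans (E-suc m n m<L)
          (sym (trans (X-⊗-suc (E m ⊕ C ⊗ E L) n) (cong (_+_ (E m n)) (C-⊗ (E L) n))))

  E-closed : ∀ m → m ≤ L → E m ≈ K ⊗ X ^ˢ m ⊗ F ⊕ C ⊗ E L ⊗ (X ⊗ geometricSum X m)
  E-closed zero    _   =
    begin
      E 0
        ≈⟨ (λ n → trans (E-zero n) (sym (const-⊗ (+ k) F n))) ⟩
      K ⊗ F
        ≈⟨ R.+-identityʳ (K ⊗ F) ⟨
      K ⊗ F ⊕ 0ˢ
        ≈⟨ R.+-cong (R.*-congʳ {F} (R.*-identityʳ K))
                    (R.trans (R.*-congˡ {C ⊗ E L} (R.zeroʳ X)) (R.zeroʳ (C ⊗ E L))) ⟨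
      K ⊗ 1ˢ ⊗ F ⊕ C ⊗ E L ⊗ (X ⊗ 0ˢ)
        ∎
  E-closed (suc m) m<L =
    begin
      E (suc m)
        ≈⟨ E-suc-series m m<L ⟩
      X ⊗ (E m ⊕ C ⊗ E L)
        ≈⟨ R.*-congˡ {X} (R.+-congʳ {C ⊗ E L} (E-closed m (ℕₚ.<⇒≤ m<L))) ⟩
      X ⊗ ((K ⊗ X ^ˢ m ⊗ F ⊕ C ⊗ E L ⊗ (X ⊗ geometricSum X m)) ⊕ C ⊗ E L)
        ≈⟨ regroup X K (X ^ˢ m) F (C ⊗ E L) (geometricSum X m) ⟩
      K ⊗ (X ⊗ X ^ˢ m) ⊗ F ⊕ C ⊗ E L ⊗ (X ⊗ (1ˢ ⊕ X ⊗ geometricSum X m))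
        ≈⟨ R.+-congˡ {K ⊗ X ^ˢ suc m ⊗ F}
             (R.*-congˡ {C ⊗ E L} (R.*-congˡ {X} (geometricSum-suc X m))) ⟨
      K ⊗ X ^ˢ suc m ⊗ F ⊕ C ⊗ E L ⊗ (X ⊗ geometricSum X (suc m))
        ∎
    where
    regroup : ∀ x k p f e g → x ⊗ ((k ⊗ p ⊗ f ⊕ e ⊗ (x ⊗ g)) ⊕ e)
                              ≈ k ⊗ (x ⊗ p) ⊗ f ⊕ e ⊗ (x ⊗ (1ˢ ⊕ x ⊗ g))
    regroup = solve 6 (λ x k p f e g →
      x :* ((k :* p :* f :+ e :* (x :* g)) :+ e) := k :* (x :* p) :* f :+ e :* (x :* (con (+ 1) :+ x :* g)))
      (λ _ → refl)

  F-equation : F ⊗ (1ˢ ⊝ K ⊗ X) ≈ 1ˢ ⊕ C ⊗ X ⊗ E L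
  F-equation =
    begin
      F ⊗ (1ˢ ⊝ K ⊗ X)
        ≈⟨ split F X K (C ⊗ E L) ⟩
      F ⊝ X ⊗ (K ⊗ F ⊕ C ⊗ E L) ⊕ X ⊗ (C ⊗ E L)
        ≈⟨ R.+-congʳ {X ⊗ (C ⊗ E L)} (R.+-congʳ { -ˢ (X ⊗ (K ⊗ F ⊕ C ⊗ E L))} F-series) ⟩
      1ˢ ⊕ X ⊗ (K ⊗ F ⊕ C ⊗ E L) ⊝ X ⊗ (K ⊗ F ⊕ C ⊗ E L) ⊕ X ⊗ (C ⊗ E L)
        ≈⟨ cancel X (K ⊗ F ⊕ C ⊗ E L) C (E L) ⟩
      1ˢ ⊕ C ⊗ X ⊗ E L
        ∎
    where
    split : ∀ f x k e → f ⊗ (1ˢ ⊝ k ⊗ x) ≈ f ⊝ x ⊗ (k ⊗ f ⊕ e) ⊕ x ⊗ e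
    split = solve 4 (λ f x k e → f :* (con (+ 1) :- k :* x) := f :- x :* (k :* f :+ e) :+ x :* e) (λ _ → refl)
    cancel : ∀ x r c e → 1ˢ ⊕ x ⊗ r ⊝ x ⊗ r ⊕ x ⊗ (c ⊗ e) ≈ 1ˢ ⊕ c ⊗ x ⊗ e
    cancel = solve 4 (λ x r c e → con (+ 1) :+ x :* r :- x :* r :+ x :* (c :* e) := con (+ 1) :+ c :* x :* e)
                     (λ _ → refl)

  E-equation : E L ⊗ (1ˢ ⊝ C ⊗ (X ⊗ G)) ≈ K ⊗ P ⊗ F
  E-equation =
    begin
      E L ⊗ (1ˢ ⊝ C ⊗ (X ⊗ G))
        ≈⟨ split (E L) C (X ⊗ G) ⟩
      E L ⊝ C ⊗ E L ⊗ (X ⊗ G)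
        ≈⟨ R.+-congʳ { -ˢ (C ⊗ E L ⊗ (X ⊗ G))} (E-closed L ℕₚ.≤-refl) ⟩
      K ⊗ P ⊗ F ⊕ C ⊗ E L ⊗ (X ⊗ G) ⊝ C ⊗ E L ⊗ (X ⊗ G)
        ≈⟨ cancel (K ⊗ P ⊗ F) (C ⊗ E L ⊗ (X ⊗ G)) ⟩
      K ⊗ P ⊗ F
        ∎
    where
    split : ∀ e c s → e ⊗ (1ˢ ⊝ c ⊗ s) ≈ e ⊝ c ⊗ e ⊗ s
    split = solve 3 (λ e c s → e :* (con (+ 1) :- c :* s) := e :- c :* e :* s) (λ _ → refl)
    cancel : ∀ a b → a ⊕ b ⊝ b ≈ a
    cancel = solve 2 (λ a b → a :+ b :- b := a) (λ _ → refl)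

  denominator : Series
  denominator = (1ˢ ⊝ K ⊗ X) ⊗ (1ˢ ⊝ C ⊗ (X ⊗ G)) ⊝ C ⊗ X ⊗ (K ⊗ P)

  F⊗denominator : F ⊗ denominator ≈ 1ˢ ⊝ C ⊗ (X ⊗ G)
  F⊗denominator =
    begin
      F ⊗ denominator
        ≈⟨ split F K X C (X ⊗ G) P ⟩
      F ⊗ (1ˢ ⊝ K ⊗ X) ⊗ (1ˢ ⊝ C ⊗ (X ⊗ G)) ⊝ C ⊗ X ⊗ (K ⊗ P ⊗ F)
        ≈⟨ R.+-cong (R.*-congʳ {1ˢ ⊝ C ⊗ (X ⊗ G)} F-equation)
                    (R.-‿cong (R.*-congˡ {C ⊗ X} (R.sym E-equation))) ⟩
      (1ˢ ⊕ C ⊗ X ⊗ E L) ⊗ (1ˢ ⊝ C ⊗ (X ⊗ G)) ⊝ C ⊗ X ⊗ (E L ⊗ (1ˢ ⊝ C ⊗ (X ⊗ G)))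
        ≈⟨ cancel (C ⊗ X) (E L) (1ˢ ⊝ C ⊗ (X ⊗ G)) ⟩
      1ˢ ⊝ C ⊗ (X ⊗ G)
        ∎
    where
    split : ∀ f k x c s p → f ⊗ ((1ˢ ⊝ k ⊗ x) ⊗ (1ˢ ⊝ c ⊗ s) ⊝ c ⊗ x ⊗ (k ⊗ p))
                            ≈ f ⊗ (1ˢ ⊝ k ⊗ x) ⊗ (1ˢ ⊝ c ⊗ s) ⊝ c ⊗ x ⊗ (k ⊗ p ⊗ f)
    split = solve 6 (λ f k x c s p →
      f :* ((con (+ 1) :- k :* x) :* (con (+ 1) :- c :* s) :- c :* x :* (k :* p))
      := f :* (con (+ 1) :- k :* x) :* (con (+ 1) :- c :* s) :- c :* x :* (k :* p :* f)) (λ _ → refl)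
    cancel : ∀ a e u → (1ˢ ⊕ a ⊗ e) ⊗ u ⊝ a ⊗ (e ⊗ u) ≈ u
    cancel = solve 3 (λ a e u → (con (+ 1) :+ a :* e) :* u :- a :* (e :* u) := u) (λ _ → refl)

  Num-closed : Num (suc L) k q ≈ 1ˢ ⊝ C ⊗ (X ⊗ G)
  Num-closed =
    begin
      Num (suc L) k q
        ≈⟨ R.+-cong (R.+-congˡ {1ˢ} (R.*-congʳ {A} (R.*-congʳ {X} (const-- (+ 1) q))))
                    (R.-‿cong (R.*-congʳ {B} (R.trans (const-* (+ 1 - q) (+ k - + 1))
                                                       (R.*-cong (const-- (+ 1) q) (const-- (+ k) (+ 1)))))) ⟩
      1ˢ ⊕ (1ˢ ⊝ Q) ⊗ X ⊗ A ⊝ (1ˢ ⊝ Q) ⊗ (K ⊝ 1ˢ) ⊗ B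
        ≈⟨ factor Q X K A B ⟩
      1ˢ ⊝ C ⊗ (X ⊗ A ⊝ (K ⊝ 1ˢ) ⊗ B)
        ≈⟨ R.+-congˡ {1ˢ} (R.-‿cong (R.*-congˡ {C} (doubleSum-collapse K L))) ⟩
      1ˢ ⊝ C ⊗ (X ⊗ G)
        ∎
    where
    A B : Series
    A = geometricSum (K ⊗ X) L
    B = doubleSum (K ⊗ X) L
    factor : ∀ q x k a b → 1ˢ ⊕ (1ˢ ⊝ q) ⊗ x ⊗ a ⊝ (1ˢ ⊝ q) ⊗ (k ⊝ 1ˢ) ⊗ b
                           ≈ 1ˢ ⊝ (q ⊝ 1ˢ) ⊗ (x ⊗ a ⊝ (k ⊝ 1ˢ) ⊗ b)
    factor = solve 5 (λ q x k a b →
      con (+ 1) :+ (con (+ 1) :- q) :* x :* a :- (con (+ 1) :- q) :* (k :- con (+ 1)) :* b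
      := con (+ 1) :- (q :- con (+ 1)) :* (x :* a :- (k :- con (+ 1)) :* b)) (λ _ → refl)

  DenTimes1-x-factor : DenTimes1-x (suc L) k q ≈ (1ˢ ⊝ X) ⊗ denominator
  DenTimes1-x-factor =
    begin
      DenTimes1-x (suc L) k q
        ≈⟨ R.+-cong (R.*-congˡ {1ˢ ⊝ X} (R.+-congˡ {1ˢ} (R.-‿cong (R.*-congʳ {X}
                      (R.trans (const-+ (+ k - + 1) q) (R.+-congʳ {Q} (const-- (+ k) (+ 1))))))))
                    (R.-‿cong (R.*-congʳ {X ^ˢ 2 ⊝ X ⊗ P} (R.trans (const-* (+ k - + 1) (+ 1 - q))
                                                          (R.*-cong (const-- (+ k) (+ 1)) (const-- (+ 1) q))))) ⟩
      (1ˢ ⊝ X) ⊗ (1ˢ ⊝ (K ⊝ 1ˢ ⊕ Q) ⊗ X) ⊝ (K ⊝ 1ˢ) ⊗ (1ˢ ⊝ Q) ⊗ (X ^ˢ 2 ⊝ X ⊗ P)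
        ≈⟨ expand X K Q G P ⟩
      (1ˢ ⊝ X) ⊗ denominator ⊕ C ⊗ (1ˢ ⊝ K ⊗ X) ⊗ X ⊗ ((1ˢ ⊝ X) ⊗ G ⊝ (1ˢ ⊝ P))
        ≈⟨ R.+-congˡ {(1ˢ ⊝ X) ⊗ denominator}
             (R.trans (R.*-congˡ {C ⊗ (1ˢ ⊝ K ⊗ X) ⊗ X}
                         (R.trans (R.+-congʳ { -ˢ (1ˢ ⊝ P)} (geometricSum-telescope X L))
                                  (R.-‿inverseʳ (1ˢ ⊝ P))))
                      (R.zeroʳ (C ⊗ (1ˢ ⊝ K ⊗ X) ⊗ X))) ⟩
      (1ˢ ⊝ X) ⊗ denominator ⊕ 0ˢ
        ≈⟨ R.+-identityʳ _ ⟩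
      (1ˢ ⊝ X) ⊗ denominator
        ∎
    where
    expand : ∀ x k q g p →
      (1ˢ ⊝ x) ⊗ (1ˢ ⊝ (k ⊝ 1ˢ ⊕ q) ⊗ x) ⊝ (k ⊝ 1ˢ) ⊗ (1ˢ ⊝ q) ⊗ (x ⊗ (x ⊗ 1ˢ) ⊝ x ⊗ p)
      ≈ (1ˢ ⊝ x) ⊗ ((1ˢ ⊝ k ⊗ x) ⊗ (1ˢ ⊝ (q ⊝ 1ˢ) ⊗ (x ⊗ g)) ⊝ (q ⊝ 1ˢ) ⊗ x ⊗ (k ⊗ p))
        ⊕ (q ⊝ 1ˢ) ⊗ (1ˢ ⊝ k ⊗ x) ⊗ x ⊗ ((1ˢ ⊝ x) ⊗ g ⊝ (1ˢ ⊝ p))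
    expand = solve 5 (λ x k q g p →
      (con (+ 1) :- x) :* (con (+ 1) :- (k :- con (+ 1) :+ q) :* x)
        :- (k :- con (+ 1)) :* (con (+ 1) :- q) :* (x :* (x :* con (+ 1)) :- x :* p)
      := (con (+ 1) :- x) :* ((con (+ 1) :- k :* x) :* (con (+ 1) :- (q :- con (+ 1)) :* (x :* g))
                               :- (q :- con (+ 1)) :* x :* (k :* p))
         :+ (q :- con (+ 1)) :* (con (+ 1) :- k :* x) :* x :* ((con (+ 1) :- x) :* g :- (con (+ 1) :- p)))
      (λ _ → refl)

  F⊗DenTimes1-x : F ⊗ DenTimes1-x (suc L) k q ≈ Num (suc L) k q ⊗ (1ˢ ⊝ X)
  F⊗DenTimes1-x =
    begin
      F ⊗ DenTimes1-x (suc L) k q         ≈⟨ R.*-congˡ {F} DenTimes1-x-factor ⟩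
      F ⊗ ((1ˢ ⊝ X) ⊗ denominator)       ≈⟨ rearrange F (1ˢ ⊝ X) denominator ⟩
      F ⊗ denominator ⊗ (1ˢ ⊝ X)         ≈⟨ R.*-congʳ {1ˢ ⊝ X} (R.trans F⊗denominator (R.sym Num-closed)) ⟩
      Num (suc L) k q ⊗ (1ˢ ⊝ X)         ∎
    where
    rearrange : ∀ f y d → f ⊗ (y ⊗ d) ≈ f ⊗ d ⊗ y
    rearrange = solve 3 (λ f y d → f :* (y :* d) := f :* d :* y) (λ _ → refl)

theorem2p1 : (l k : ℕ) → 1 ≤ l → 1 ≤ k → (q : ℤ) → (n : ℕ) →
    (Fτ l k q ⊗ DenTimes1-x l k q) n ≡ (Num l k q ⊗ (const (+ 1) ⊝ X)) n
-- The identity holds for k = 0 as well.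
theorem2p1 (suc L) k (s≤s z≤n) _ q = Main.F⊗DenTimes1-x k L q
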